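{- Let $m\ge1$, $n\ge0$, $k\ge0$ be integers. There is a bijection between the $k$-element subsets of $\{1,2,\ldots,n\}$ in which no two elements differ by $m$, and the tilings of an $(n+m)$-board using exactly $k$ $(1,m-1)$-fences and $n+m-2k$ squares.
   Context: An $N$-board is a linear array of $N$ unit square cells. A square is a $1\times1$ tile. For $m\ge1$, a $(1,m-1)$-fence is a tile consisting of two unit square sub-tiles (posts) separated by a gap of width $m-1$ (for $m=1$ it is a domino); when tiling, the gap of a fence may be occupied by other tiles, including posts of other fences. -}

module Defs where

open import Data.Nat using (ℕ; zero; suc; _+_; _*_; _∸_; _≤_; _<ᵇ_)
open import Data.Bool using (Bool; true; false; _∧_; _∨_; not; if_then_else_; T)
open import Data.Vec using (Vec; []; _∷_)
open import Data.Fin.Subset using (Subset; ∣_∣)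
open import Data.Product using (Σ; _×_)
open import Relation.Binary.PropositionalEquality using (_≡_)

-- Cells of a board / elements of {1,…,n} are indexed from 0:
-- position i : ℕ (with i < length) stands for cell i+1 / element i+1.

-- Membership of a natural number in a subset (false when out of range).
_∈ᵇ_ : ∀ {N} → ℕ → Subset N → Bool
_ ∈ᵇ [] = false
zero ∈ᵇ (b ∷ v) = b
suc i ∈ᵇ (b ∷ v) = i ∈ᵇ v

allBelow : ℕ → (ℕ → Bool) → Bool
allBelow zero P = true
allBelow (suc N) P = allBelow N P ∧ P N

b2n : Bool → ℕ
b2n true = 1
b2n false = 0

_==_ : ℕ → ℕ → Bool
zero == zero = true
zero == suc _ = false
suc _ == zero = false
suc a == suc b = a == b

noDiff : ∀ {n} → ℕ → Subset n → Bool
noDiff {n} m p = allBelow n (λ i → not ((i ∈ᵇ p) ∧ ((i + m) ∈ᵇ p)))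

SubsetsNoDiff : (n m k : ℕ) → Set
SubsetsNoDiff n m k = Σ (Subset n) (λ p → ∣ p ∣ ≡ k × T (noDiff m p))

-- A tiling of an N-board by squares and (1,m-1)-fences is given by
--   S : the set of cells occupied by squares,
--   F : the set of cells occupied by the LEFT post of a fence
--       (whose right post then occupies cell i+m),
-- such that every fence lies on the board and every cell is covered
-- by exactly one tile piece (square, left post, or right post).
coverCount : ∀ {N} → ℕ → Subset N → Subset N → ℕ → ℕ
coverCount m S F c =
  b2n (c ∈ᵇ S) + b2n (c ∈ᵇ F) + (if c <ᵇ m then 0 else b2n ((c ∸ m) ∈ᵇ F))

isTiling : ∀ {N} → ℕ → Subset N → Subset N → Bool
isTiling {N} m S F =
  allBelow N (λ i → not (i ∈ᵇ F) ∨ ((i + m) <ᵇ N))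
  ∧ allBelow N (λ c → coverCount m S F c == 1)

Tilings : (N m k s : ℕ) → Set
Tilings N m k s =
  Σ (Subset N × Subset N) λ SF →
    T (isTiling m (Data.Product.proj₁ SF) (Data.Product.proj₂ SF))
    × ∣ Data.Product.proj₂ SF ∣ ≡ k
    × ∣ Data.Product.proj₁ SF ∣ ≡ s

{-# OPTIONS --safe #-}
module Submission where

open import Defs
open import Data.Nat using (ℕ; zero; suc; _+_; _*_; _∸_; _≤_; _<_; _<ᵇ_; s≤s; z<s)
open import Data.Nat.Properties
  using (_<?_; ≮⇒≥; ≤-refl; ≤-trans; m≤m+n; m≤n⇒m≤1+n; m<1+n⇒m<n∨m≡n;
         +-cancelʳ-<; +-monoˡ-<; +-comm; +-assoc; +-identityʳ; m+n∸n≡m;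
         <ᵇ⇒<; <⇒<ᵇ; ≡-irrelevant; +-commutativeSemigroup)
open import Algebra.Properties.CommutativeSemigroup +-commutativeSemigroup
  using (interchange)
open import Data.Bool using (Bool; true; false; _∧_; _∨_; not; T; if_then_else_)
open import Data.Bool.Properties using (T-∧; T-irrelevant)
open import Data.Unit using (tt)
open import Data.Empty using (⊥; ⊥-elim)
open import Data.Vec using ([]; _∷_)
open import Data.Fin.Subset using (Subset; ∣_∣)
open import Data.Product using (Σ; ∃; _×_; _,_; proj₁; proj₂)
open import Data.Sum using (inj₁; inj₂)
open import Function using (_∘_)
open import Function.Bundles using (_⤖_; Equivalence; mk↔ₛ′)
open import Function.Properties.Inverse using (↔⇒⤖)
open import Relation.Nullary using (yes; no)
open import Relation.Nullary.Irrelevant using (Irrelevant)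
open import Relation.Binary.PropositionalEquality
  using (_≡_; refl; sym; trans; cong; cong₂; subst; module ≡-Reasoning)

-- A set p of the admissible kind is read as the set of left posts of fences:
-- a fence with left post i has its right post at i + m ≤ n + m, so it
-- fits on the (n+m)-board, and "no two elements differ by m" says exactly
-- that no right post lands on a left post. The remaining cells are covered
-- by squares, and since every cell is covered once, a tiling with k fences
-- has n + m − 2k squares. Conversely, the left posts of any tiling lie in
-- the first n cells and form such a set.

==⇒≡ : ∀ {a b} → T (a == b) → a ≡ b
==⇒≡ {zero} {zero} _ = refl
==⇒≡ {suc a} {suc b} t = cong suc (==⇒≡ t)

allBelow⁻ : ∀ {N} P → T (allBelow N P) → ∀ {i} → i < N → T (P i)
allBelow⁻ {suc N} P t i<1+N with Equivalence.to T-∧ t | m<1+n⇒m<n∨m≡n i<1+N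
... | below , _ | inj₁ i<N = allBelow⁻ P below i<N
... | _ , last | inj₂ refl = last

allBelow⁺ : ∀ N P → (∀ i → i < N → T (P i)) → T (allBelow N P)
allBelow⁺ zero P h = tt
allBelow⁺ (suc N) P h = Equivalence.from T-∧
  (allBelow⁺ N P (λ i i<N → h i (m≤n⇒m≤1+n i<N)) , h N ≤-refl)

b2n³-cong : ∀ {a a′ b b′ c c′} → a ≡ a′ → b ≡ b′ → c ≡ c′ →
  b2n a + b2n b + b2n c ≡ b2n a′ + b2n b′ + b2n c′
b2n³-cong refl refl refl = refl

exactlyOne⇒nor : ∀ s a b → b2n s + b2n a + b2n b ≡ 1 → s ≡ not a ∧ not b
exactlyOne⇒nor true false false _ = refl
exactlyOne⇒nor false true false _ = refl
exactlyOne⇒nor false false true _ = refl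
exactlyOne⇒nor false false false ()
exactlyOne⇒nor true true _ ()
exactlyOne⇒nor true false true ()
exactlyOne⇒nor false true true ()

exactlyOne⇒disjoint : ∀ s a b → b2n s + b2n a + b2n b ≡ 1 → a ≡ true → b ≡ true → ⊥
exactlyOne⇒disjoint true true true () refl refl
exactlyOne⇒disjoint false true true () refl refl

nor-exactlyOne : ∀ a b → (a ≡ true → b ≡ true → ⊥) → b2n (not a ∧ not b) + b2n a + b2n b ≡ 1
nor-exactlyOne true true disjoint = ⊥-elim (disjoint refl refl)
nor-exactlyOne true false _ = refl
nor-exactlyOne false true _ = refl
nor-exactlyOne false false _ = refl

tabulateᵇ : (N : ℕ) → (ℕ → Bool) → Subset N
tabulateᵇ zero f = []
tabulateᵇ (suc N) f = f 0 ∷ tabulateᵇ N (f ∘ suc)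

∈ᵇ-tabulateᵇ : ∀ N f {i} → i < N → i ∈ᵇ tabulateᵇ N f ≡ f i
∈ᵇ-tabulateᵇ (suc N) f {zero} _ = refl
∈ᵇ-tabulateᵇ (suc N) f {suc i} (s≤s i<N) = ∈ᵇ-tabulateᵇ N (f ∘ suc) i<N

∈ᵇ-≥ : ∀ {N} (v : Subset N) {i} → N ≤ i → i ∈ᵇ v ≡ false
∈ᵇ-≥ [] _ = refl
∈ᵇ-≥ (b ∷ v) {suc i} (s≤s N≤i) = ∈ᵇ-≥ v N≤i

∈ᵇ⇒< : ∀ {N} (v : Subset N) {i} → i ∈ᵇ v ≡ true → i < N
∈ᵇ⇒< {N} v {i} i∈v with i <? N
... | yes i<N = i<N
... | no i≮N with trans (sym i∈v) (∈ᵇ-≥ v (≮⇒≥ i≮N))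
...   | ()

≡-by-∈ᵇ : ∀ {N} (v w : Subset N) → (∀ i → i < N → i ∈ᵇ v ≡ i ∈ᵇ w) → v ≡ w
≡-by-∈ᵇ [] [] _ = refl
≡-by-∈ᵇ (a ∷ v) (b ∷ w) h =
  cong₂ _∷_ (h 0 z<s) (≡-by-∈ᵇ v w (λ i i<N → h (suc i) (s≤s i<N)))

∣∷∣ : ∀ {N} b (v : Subset N) → ∣ b ∷ v ∣ ≡ b2n b + ∣ v ∣
∣∷∣ true v = refl
∣∷∣ false v = refl

∣∣≡0 : ∀ {N} (v : Subset N) → (∀ i → i ∈ᵇ v ≡ false) → ∣ v ∣ ≡ 0
∣∣≡0 [] _ = refl
∣∣≡0 (b ∷ v) h rewrite h 0 = ∣∣≡0 v (h ∘ suc)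

∣∣-cong : ∀ {L L′} (v : Subset L) (w : Subset L′) → (∀ i → i ∈ᵇ v ≡ i ∈ᵇ w) → ∣ v ∣ ≡ ∣ w ∣
∣∣-cong [] w h = sym (∣∣≡0 w (sym ∘ h))
∣∣-cong (a ∷ v) [] h = ∣∣≡0 (a ∷ v) h
∣∣-cong (a ∷ v) (b ∷ w) h = begin
  ∣ a ∷ v ∣      ≡⟨ ∣∷∣ a v ⟩
  b2n a + ∣ v ∣  ≡⟨ cong₂ _+_ (cong b2n (h 0)) (∣∣-cong v w (h ∘ suc)) ⟩
  b2n b + ∣ w ∣  ≡⟨ sym (∣∷∣ b w) ⟩
  ∣ b ∷ w ∣      ∎
  where open ≡-Reasoning

restrict : ∀ N {L} → Subset L → Subset N
restrict N v = tabulateᵇ N (_∈ᵇ v)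

∈ᵇ-restrict : ∀ N {L} (v : Subset L) → (∀ i → i ∈ᵇ v ≡ true → i < N) →
  ∀ i → i ∈ᵇ restrict N v ≡ i ∈ᵇ v
∈ᵇ-restrict N v bounded i with i <? N
... | yes i<N = ∈ᵇ-tabulateᵇ N (_∈ᵇ v) i<N
... | no i≮N with i ∈ᵇ v in i∈v
...   | false = ∈ᵇ-≥ (restrict N v) (≮⇒≥ i≮N)
...   | true = ⊥-elim (i≮N (bounded i i∈v))

∣restrict∣ : ∀ N {L} (v : Subset L) → (∀ i → i ∈ᵇ v ≡ true → i < N) → ∣ restrict N v ∣ ≡ ∣ v ∣
∣restrict∣ N v bounded = ∣∣-cong (restrict N v) v (∈ᵇ-restrict N v bounded)

coverBy : ∀ {L₁ L₂ L₃} → Subset L₁ → Subset L₂ → Subset L₃ → ℕ → ℕ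
coverBy S F R c = b2n (c ∈ᵇ S) + b2n (c ∈ᵇ F) + b2n (c ∈ᵇ R)

∣∣-partition : ∀ {N} (S F R : Subset N) → (∀ c → c < N → coverBy S F R c ≡ 1) →
  ∣ S ∣ + ∣ F ∣ + ∣ R ∣ ≡ N
∣∣-partition [] [] [] _ = refl
∣∣-partition (s ∷ S) (f ∷ F) (r ∷ R) once = begin
  ∣ s ∷ S ∣ + ∣ f ∷ F ∣ + ∣ r ∷ R ∣
    ≡⟨ cong₂ _+_ (cong₂ _+_ (∣∷∣ s S) (∣∷∣ f F)) (∣∷∣ r R) ⟩
  (b2n s + ∣ S ∣) + (b2n f + ∣ F ∣) + (b2n r + ∣ R ∣)
    ≡⟨ cong (_+ (b2n r + ∣ R ∣)) (interchange (b2n s) (∣ S ∣) (b2n f) (∣ F ∣)) ⟩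
  (b2n s + b2n f) + (∣ S ∣ + ∣ F ∣) + (b2n r + ∣ R ∣)
    ≡⟨ interchange (b2n s + b2n f) (∣ S ∣ + ∣ F ∣) (b2n r) (∣ R ∣) ⟩
  coverBy (s ∷ S) (f ∷ F) (r ∷ R) 0 + (∣ S ∣ + ∣ F ∣ + ∣ R ∣)
    ≡⟨ cong₂ _+_ (once 0 z<s) (∣∣-partition S F R (λ c c<N → once (suc c) (s≤s c<N))) ⟩
  suc _ ∎
  where open ≡-Reasoning

rightPosts : ∀ {L} (m : ℕ) → Subset L → Subset (m + L)
rightPosts zero v = v
rightPosts (suc m) v = false ∷ rightPosts m v

∈ᵇ-rightPosts-+ : ∀ {L} m (v : Subset L) i → (m + i) ∈ᵇ rightPosts m v ≡ i ∈ᵇ v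
∈ᵇ-rightPosts-+ zero v i = refl
∈ᵇ-rightPosts-+ (suc m) v i = ∈ᵇ-rightPosts-+ m v i

∈ᵇ-rightPosts⁻ : ∀ {L} m (v : Subset L) {c} → c ∈ᵇ rightPosts m v ≡ true → ∃ λ i → c ≡ m + i
∈ᵇ-rightPosts⁻ zero v {c} _ = c , refl
∈ᵇ-rightPosts⁻ (suc m) v {zero} ()
∈ᵇ-rightPosts⁻ (suc m) v {suc c} c∈R with ∈ᵇ-rightPosts⁻ m v c∈R
... | i , refl = i , refl

rightPosts-cong : ∀ {L L′} m (v : Subset L) (w : Subset L′) → (∀ i → i ∈ᵇ v ≡ i ∈ᵇ w) →
  ∀ c → c ∈ᵇ rightPosts m v ≡ c ∈ᵇ rightPosts m w
rightPosts-cong zero v w h c = h c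
rightPosts-cong (suc m) v w h zero = refl
rightPosts-cong (suc m) v w h (suc c) = rightPosts-cong m v w h c

∣rightPosts∣ : ∀ {L} m (v : Subset L) → ∣ rightPosts m v ∣ ≡ ∣ v ∣
∣rightPosts∣ zero v = refl
∣rightPosts∣ (suc m) v = ∣rightPosts∣ m v

coverCount≡coverBy : ∀ {N} m (S F : Subset N) c → coverCount m S F c ≡ coverBy S F (rightPosts m F) c
coverCount≡coverBy m S F c = cong (b2n (c ∈ᵇ S) + b2n (c ∈ᵇ F) +_) (rightPost m c)
  where
  rightPost : ∀ m c → (if c <ᵇ m then 0 else b2n ((c ∸ m) ∈ᵇ F)) ≡ b2n (c ∈ᵇ rightPosts m F)
  rightPost zero c = refl
  rightPost (suc m) zero = refl
  rightPost (suc m) (suc c) = rightPost m c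

record IsTiling {N} (m : ℕ) (S F : Subset N) : Set where
  field
    fence-fits : ∀ i → i ∈ᵇ F ≡ true → i + m < N
    covered-once : ∀ c → c < N → coverBy S F (rightPosts m F) c ≡ 1

isTiling⁺ : ∀ {N m} {S F : Subset N} → IsTiling m S F → T (isTiling m S F)
isTiling⁺ {N} {m} {S} {F} t = Equivalence.from T-∧
  ( allBelow⁺ N _ (λ i _ → fits i)
  , allBelow⁺ N _ (λ c c<N → ≡⇒== (trans (coverCount≡coverBy m S F c) (covered-once c c<N))))
  where
  open IsTiling t
  fits : ∀ i → T (not (i ∈ᵇ F) ∨ (i + m <ᵇ N))
  fits i with i ∈ᵇ F in i∈F
  ... | false = tt
  ... | true = <⇒<ᵇ (fence-fits i i∈F)
  ≡⇒== : ∀ {x} → x ≡ 1 → T (x == 1)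
  ≡⇒== refl = tt

isTiling⁻ : ∀ {N} m (S F : Subset N) → T (isTiling m S F) → IsTiling m S F
isTiling⁻ {N} m S F t = record
  { fence-fits = λ i i∈F → <ᵇ⇒< (i + m) N (implies i∈F (allBelow⁻ _ fits (∈ᵇ⇒< F i∈F)))
  ; covered-once = λ c c<N →
      trans (sym (coverCount≡coverBy m S F c)) (==⇒≡ (allBelow⁻ _ once c<N))
  }
  where
  fits : T (allBelow N (λ i → not (i ∈ᵇ F) ∨ (i + m <ᵇ N)))
  fits = proj₁ (Equivalence.to T-∧ t)
  once : T (allBelow N (λ c → coverCount m S F c == 1))
  once = proj₂ (Equivalence.to T-∧ t)
  implies : ∀ {a b} → a ≡ true → T (not a ∨ b) → T b
  implies refl t = t

module _ {N m} {S F : Subset N} (tiling : IsTiling m S F) where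

  open IsTiling tiling

  rightPost-< : ∀ c → c ∈ᵇ rightPosts m F ≡ true → c < N
  rightPost-< c c∈R with ∈ᵇ-rightPosts⁻ m F c∈R
  ... | i , refl = subst (_< N) (+-comm i m)
    (fence-fits i (trans (sym (∈ᵇ-rightPosts-+ m F i)) c∈R))

  leftPosts-noDiff : ∀ i → i ∈ᵇ F ≡ true → (i + m) ∈ᵇ F ≡ true → ⊥
  leftPosts-noDiff i i∈F i+m∈F = exactlyOne⇒disjoint _ _ _
    (covered-once (i + m) (fence-fits i i∈F)) i+m∈F
    (trans (cong (_∈ᵇ rightPosts m F) (+-comm i m)) (trans (∈ᵇ-rightPosts-+ m F i) i∈F))

  squares+fences : ∣ S ∣ + ∣ F ∣ + ∣ F ∣ ≡ N
  squares+fences = begin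
    ∣ S ∣ + ∣ F ∣ + ∣ F ∣
      ≡⟨ cong (∣ S ∣ + ∣ F ∣ +_) (sym (trans (∣restrict∣ N R rightPost-<) (∣rightPosts∣ m F))) ⟩
    ∣ S ∣ + ∣ F ∣ + ∣ restrict N R ∣
      ≡⟨ ∣∣-partition S F (restrict N R) once ⟩
    N ∎
    where
    open ≡-Reasoning
    R : Subset (m + N)
    R = rightPosts m F
    once : ∀ c → c < N → coverBy S F (restrict N R) c ≡ 1
    once c c<N = trans
      (cong (λ x → b2n (c ∈ᵇ S) + b2n (c ∈ᵇ F) + b2n x) (∈ᵇ-restrict N R rightPost-< c))
      (covered-once c c<N)

  squares≡ : ∣ S ∣ ≡ N ∸ 2 * ∣ F ∣
  squares≡ = begin
    ∣ S ∣
      ≡⟨ sym (m+n∸n≡m (∣ S ∣) (2 * ∣ F ∣)) ⟩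
    ∣ S ∣ + 2 * ∣ F ∣ ∸ 2 * ∣ F ∣
      ≡⟨ cong (λ x → ∣ S ∣ + (∣ F ∣ + x) ∸ 2 * ∣ F ∣) (+-identityʳ (∣ F ∣)) ⟩
    ∣ S ∣ + (∣ F ∣ + ∣ F ∣) ∸ 2 * ∣ F ∣
      ≡⟨ cong (_∸ 2 * ∣ F ∣) (sym (+-assoc (∣ S ∣) (∣ F ∣) (∣ F ∣))) ⟩
    ∣ S ∣ + ∣ F ∣ + ∣ F ∣ ∸ 2 * ∣ F ∣
      ≡⟨ cong (_∸ 2 * ∣ F ∣) squares+fences ⟩
    N ∸ 2 * ∣ F ∣ ∎
    where open ≡-Reasoning

Σ-≡-irrelevant : ∀ {A : Set} {B : A → Set} → (∀ {x} → Irrelevant (B x)) →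
  {u v : Σ A B} → proj₁ u ≡ proj₁ v → u ≡ v
Σ-≡-irrelevant irr {a , b} {.a , c} refl = cong (a ,_) (irr b c)

×-irrelevant : ∀ {A B : Set} → Irrelevant A → Irrelevant B → Irrelevant (A × B)
×-irrelevant irrA irrB (a , b) (a′ , b′) = cong₂ _,_ (irrA a a′) (irrB b b′)

noDiff⁻ : ∀ {n} m (p : Subset n) → T (noDiff m p) →
  ∀ i → i ∈ᵇ p ≡ true → (i + m) ∈ᵇ p ≡ true → ⊥
noDiff⁻ m p nd i i∈p i+m∈p =
  notBoth i∈p i+m∈p (allBelow⁻ (λ i → not ((i ∈ᵇ p) ∧ ((i + m) ∈ᵇ p))) nd (∈ᵇ⇒< p i∈p))
  where
  notBoth : ∀ {a b} → a ≡ true → b ≡ true → T (not (a ∧ b)) → ⊥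
  notBoth refl refl ()

noDiff⁺ : ∀ {n} m (p : Subset n) →
  (∀ i → i ∈ᵇ p ≡ true → (i + m) ∈ᵇ p ≡ true → ⊥) → T (noDiff m p)
noDiff⁺ {n} m p disjoint = allBelow⁺ n _ (λ i _ → notBoth i)
  where
  notBoth : ∀ i → T (not ((i ∈ᵇ p) ∧ ((i + m) ∈ᵇ p)))
  notBoth i with i ∈ᵇ p in i∈p | (i + m) ∈ᵇ p in i+m∈p
  ... | false | _ = tt
  ... | true | false = tt
  ... | true | true = disjoint i i∈p i+m∈p

module _ (m n : ℕ) where

  fencesOf : Subset n → Subset (n + m)
  fencesOf = restrict (n + m)

  squaresOf : Subset n → Subset (n + m)
  squaresOf p = tabulateᵇ (n + m) (λ c → not (c ∈ᵇ p) ∧ not (c ∈ᵇ rightPosts m p))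

  ∈ᵇ-fencesOf : ∀ p i → i ∈ᵇ fencesOf p ≡ i ∈ᵇ p
  ∈ᵇ-fencesOf p = ∈ᵇ-restrict (n + m) p (λ i i∈p → ≤-trans (∈ᵇ⇒< p i∈p) (m≤m+n n m))

  noDiff⇒isTiling : ∀ p → T (noDiff m p) → IsTiling m (squaresOf p) (fencesOf p)
  noDiff⇒isTiling p nd = record { fence-fits = fits ; covered-once = once }
    where
    fits : ∀ i → i ∈ᵇ fencesOf p ≡ true → i + m < n + m
    fits i i∈F = +-monoˡ-< m (∈ᵇ⇒< p (trans (sym (∈ᵇ-fencesOf p i)) i∈F))

    disjoint : ∀ c → c ∈ᵇ p ≡ true → c ∈ᵇ rightPosts m p ≡ true → ⊥
    disjoint c c∈p c∈R with ∈ᵇ-rightPosts⁻ m p c∈R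
    ... | i , refl = noDiff⁻ m p nd i
      (trans (sym (∈ᵇ-rightPosts-+ m p i)) c∈R) (subst (λ x → x ∈ᵇ p ≡ true) (+-comm m i) c∈p)

    once : ∀ c → c < n + m →
      coverBy (squaresOf p) (fencesOf p) (rightPosts m (fencesOf p)) c ≡ 1
    once c c<N = trans
      (b2n³-cong (∈ᵇ-tabulateᵇ (n + m) _ c<N) (∈ᵇ-fencesOf p c)
                 (rightPosts-cong m (fencesOf p) p (∈ᵇ-fencesOf p) c))
      (nor-exactlyOne _ _ (disjoint c))

  module _ {S F : Subset (n + m)} (tiling : IsTiling m S F) where

    leftPost-< : ∀ i → i ∈ᵇ F ≡ true → i < n
    leftPost-< i i∈F = +-cancelʳ-< m i n (IsTiling.fence-fits tiling i i∈F)

    ∈ᵇ-restrict-leftPosts : ∀ i → i ∈ᵇ restrict n F ≡ i ∈ᵇ F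
    ∈ᵇ-restrict-leftPosts = ∈ᵇ-restrict n F leftPost-<

    restrict-noDiff : T (noDiff m (restrict n F))
    restrict-noDiff = noDiff⁺ m (restrict n F) λ i i∈p i+m∈p → leftPosts-noDiff tiling i
      (trans (sym (∈ᵇ-restrict-leftPosts i)) i∈p)
      (trans (sym (∈ᵇ-restrict-leftPosts (i + m))) i+m∈p)

    fencesOf-restrict : fencesOf (restrict n F) ≡ F
    fencesOf-restrict = ≡-by-∈ᵇ _ F λ i _ →
      trans (∈ᵇ-fencesOf (restrict n F) i) (∈ᵇ-restrict-leftPosts i)

    squaresOf-restrict : squaresOf (restrict n F) ≡ S
    squaresOf-restrict = ≡-by-∈ᵇ _ S λ c c<N → begin
      c ∈ᵇ squaresOf (restrict n F)
        ≡⟨ ∈ᵇ-tabulateᵇ (n + m) _ c<N ⟩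
      not (c ∈ᵇ restrict n F) ∧ not (c ∈ᵇ rightPosts m (restrict n F))
        ≡⟨ cong₂ (λ a b → not a ∧ not b) (∈ᵇ-restrict-leftPosts c)
                 (rightPosts-cong m _ F ∈ᵇ-restrict-leftPosts c) ⟩
      not (c ∈ᵇ F) ∧ not (c ∈ᵇ rightPosts m F)
        ≡⟨ sym (exactlyOne⇒nor _ _ _ (IsTiling.covered-once tiling c c<N)) ⟩
      c ∈ᵇ S ∎
      where open ≡-Reasoning

  module _ (k : ℕ) where

    toTiling : SubsetsNoDiff n m k → Tilings (n + m) m k (n + m ∸ 2 * k)
    toTiling (p , ∣p∣≡k , nd) = (squaresOf p , fencesOf p) , isTiling⁺ tiling , ∣F∣≡k ,
      trans (squares≡ tiling) (cong (λ x → n + m ∸ 2 * x) ∣F∣≡k)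
      where
      tiling : IsTiling m (squaresOf p) (fencesOf p)
      tiling = noDiff⇒isTiling p nd
      ∣F∣≡k : ∣ fencesOf p ∣ ≡ k
      ∣F∣≡k = trans (∣∣-cong (fencesOf p) p (∈ᵇ-fencesOf p)) ∣p∣≡k

    fromTiling : Tilings (n + m) m k (n + m ∸ 2 * k) → SubsetsNoDiff n m k
    fromTiling ((S , F) , tiling , ∣F∣≡k , _) =
      restrict n F , trans (∣restrict∣ n F (leftPost-< t)) ∣F∣≡k , restrict-noDiff t
      where
      t : IsTiling m S F
      t = isTiling⁻ m S F tiling

    fromTiling∘toTiling : ∀ x → fromTiling (toTiling x) ≡ x
    fromTiling∘toTiling (p , _ , nd) = Σ-≡-irrelevant (×-irrelevant ≡-irrelevant T-irrelevant)
      (≡-by-∈ᵇ _ p λ i _ →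
        trans (∈ᵇ-restrict-leftPosts (noDiff⇒isTiling p nd) i) (∈ᵇ-fencesOf p i))

    toTiling∘fromTiling : ∀ y → toTiling (fromTiling y) ≡ y
    toTiling∘fromTiling ((S , F) , tiling , _) =
      Σ-≡-irrelevant (×-irrelevant T-irrelevant (×-irrelevant ≡-irrelevant ≡-irrelevant))
        (cong₂ _,_ (squaresOf-restrict t) (fencesOf-restrict t))
      where
      t : IsTiling m S F
      t = isTiling⁻ m S F tiling

lemma16 : (m n k : ℕ) → 1 ≤ m →
    SubsetsNoDiff n m k ⤖ Tilings (n + m) m k (n + m ∸ 2 * k)
lemma16 m n k _ = ↔⇒⤖ (mk↔ₛ′ (toTiling m n k) (fromTiling m n k)
  (toTiling∘fromTiling m n k) (fromTiling∘toTiling m n k))
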